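{- Let $p\geq1$, let $n=m(p+1)+j$ with $m\geq 1$ and $0\leq j\leq p$, and treat $(a_k)_{k\in\mathbb{Z}}$ as indeterminates. With the collections of paths and weight polynomials defined in the context, the following hold: (i) The first $p$ steps of any path in $\mathcal{S}_{[n,j]}$ are the upsteps $(k,k)\to(k+1,k+1)$, $0\leq k\leq p-1$. (ii) If $j=0$, the last step of any path in $\mathcal{S}_{[m(p+1),0]}$ is the downstep $(m(p+1)-1,p)\to(m(p+1),0)$. (iii) $R_{[n,j]}$, $S_{[n,j]}$, $T_{[n,j]}$ are homogeneous polynomials of degree $m$ in the variables $\{a_k:-mp\leq k\leq (m-1)p+j\}$, $\{a_k:0\leq k\leq (m-1)p+j\}$, and $\{a_k:-j-mp\leq k\leq -p\}$, respectively. (iv) The map $\gamma\mapsto\widehat\gamma$, where $\widehat\gamma$ is obtained from $\gamma$ by reflecting in the horizontal axis and then reflecting the result in the vertical line $x=n/2$, is a bijection from $\mathcal{S}_{[n,j]}$ onto $\widehat{\mathcal{S}}_{[n,j]}$. Consequently, writing $S_{[n,j]}=S_{[n,j]}(a_0,a_1,\ldots,a_{(m-1)p+j})$, we have $T_{[n,j]}=S_{[n,j]}(a_{ -p},a_{ -p-1},\ldots,a_{ -mp-j})$, i.e., $T_{[n,j]}$ is obtained from $S_{[n,j]}$ by replacing $a_k$ by $a_{ -p-k}$ for each $0\leq k\leq (m-1)p+j$. (v) $\mathrm{card}(\mathcal{R}_{[n,j]})=\binom{m(p+1)+j}{m}$ and $\mathrm{card}(\mathcal{S}_{[n,j]})=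\frac{j+1}{pm+j+1}\binom{m(p+1)+j}{m}$.
   Context: Consider lattice paths with vertices in $\mathbb{Z}_{\geq0}\times\mathbb{Z}$, given as finite sequences of steps (consecutive steps sharing endpoints), where only two kinds of steps are allowed: upsteps $(n,m)\to(n+1,m+1)$, of weight $1$, and downsteps $(n,m)\to(n+1,m-p)$ (down by exactly $p$ units), of weight $a_{m-p}$. The length of a path is its number of steps; its weight $w(\gamma)$ is the product of the weights of its steps. $\min(\gamma)$, $\max(\gamma)$ are the minimal and maximal heights of its vertices. For $n\geq0$ and $0\leq j\leq p$: $\mathcal{R}_{[n,j]}$ is the set of such paths of length $n$ from $(0,0)$ to $(n,j)$; $\mathcal{S}_{[n,j]}$ is the set of paths in $\mathcal{R}_{[n,j]}$ with $\min(\gamma)=0$; $\widehat{\mathcal{S}}_{[n,j]}$ is the set of such paths of length $n$ from $(0,-j)$ to $(n,0)$ with $\max(\gamma)=0$. Define $R_{[n,j]}=\sum_{\gamma\in\mathcal{R}_{[n,j]}}w(\gamma)$, $S_{[n,j]}=\sum_{\gamma\in\mathcal{S}_{[n,j]}}w(\gamma)$, $T_{[n,j]}=\sum_{\gamma\in\widehat{\mathcal{S}}_{[n,j]}}w(\gamma)$. -}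

module Defs where

open import Level using (0ℓ)
open import Algebra.Bundles using (CommutativeSemiring)
open import Data.Bool using (if_then_else_)
open import Data.Nat as ℕ using (ℕ; zero; suc)
open import Data.Integer as ℤ using (ℤ; +_; -_; _⊓_; _⊔_)
open import Data.Product using (_×_; _,_; proj₁; proj₂)
open import Data.List using (List; []; _∷_; _++_; map; filter; length; foldr; reverse)
open import Data.List.Relation.Unary.All using (All)
open import Relation.Binary.PropositionalEquality using (_≡_)
open import Relation.Nullary using (Dec; does)
open import Relation.Nullary.Decidable using (_×-dec_)

-- Lattice paths with upsteps (+1,+1) and downsteps (+1,-p).
-- A path is given by its starting vertex (0,h) and its list of steps.

data Step : Set where
  up down : Step

stepH : ℕ → ℤ → Step → ℤ
stepH p h up   = h ℤ.+ + 1
stepH p h down = h ℤ.- + p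

endHeight : ℕ → ℤ → List Step → ℤ
endHeight p h []      = h
endHeight p h (s ∷ γ) = endHeight p (stepH p h s) γ

vertices : ℕ → ℕ → ℤ → List Step → List (ℕ × ℤ)
vertices p x h []      = (x , h) ∷ []
vertices p x h (s ∷ γ) = (x , h) ∷ vertices p (suc x) (stepH p h s) γ

minH : ℕ → ℤ → List Step → ℤ
minH p h γ = foldr _⊓_ h (map proj₂ (vertices p 0 h γ))

maxH : ℕ → ℤ → List Step → ℤ
maxH p h γ = foldr _⊔_ h (map proj₂ (vertices p 0 h γ))

-- A monomial in the indeterminates (a_k)_{k ∈ ℤ} is a list of
-- indices (the list [k₁,…,k_d] stands for a_{k₁}⋯a_{k_d}); a polynomial
-- with coefficients in ℕ is a formal sum (list) of monomials.

Monomial : Set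
Monomial = List ℤ

Poly : Set
Poly = List Monomial

weight : ℕ → ℤ → List Step → Monomial
weight p h []         = []
weight p h (up ∷ γ)   = weight p (stepH p h up) γ
weight p h (down ∷ γ) = (h ℤ.- + p) ∷ weight p (stepH p h down) γ

evalMono : (R : CommutativeSemiring 0ℓ 0ℓ) → (ℤ → CommutativeSemiring.Carrier R) →
           Monomial → CommutativeSemiring.Carrier R
evalMono R a []      = CommutativeSemiring.1# R
evalMono R a (k ∷ μ) = CommutativeSemiring._*_ R (a k) (evalMono R a μ)

evalPoly : (R : CommutativeSemiring 0ℓ 0ℓ) → (ℤ → CommutativeSemiring.Carrier R) →
           Poly → CommutativeSemiring.Carrier R
evalPoly R a []      = CommutativeSemiring.0# R
evalPoly R a (μ ∷ P) = CommutativeSemiring._+_ R (evalMono R a μ) (evalPoly R a P)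

-- equality of polynomials in ℕ[a_k : k ∈ ℤ] : equal evaluations in every
-- commutative semiring (i.e. equality in the free commutative semiring)
_≈P_ : Poly → Poly → Set₁
P ≈P Q = (R : CommutativeSemiring 0ℓ 0ℓ) (a : ℤ → CommutativeSemiring.Carrier R) →
         CommutativeSemiring._≈_ R (evalPoly R a P) (evalPoly R a Q)

rename : (ℤ → ℤ) → Poly → Poly
rename f P = map (map f) P

-- P is homogeneous of degree d in the variables {a_k : V k}:
-- every monomial (all coefficients are in ℕ, so no cancellation) has degree d
-- and only involves variables a_k with V k
IsHomogeneous : ℕ → (ℤ → Set) → Poly → Set
IsHomogeneous d V P = All (λ μ → length μ ≡ d × All V μ) P

Between : ℤ → ℤ → ℤ → Set
Between lo hi k = lo ℤ.≤ k × k ℤ.≤ hi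

IsR : ℕ → ℕ → ℕ → List Step → Set
IsR p n j γ = length γ ≡ n × endHeight p (+ 0) γ ≡ + j

IsS : ℕ → ℕ → ℕ → List Step → Set
IsS p n j γ = IsR p n j γ × minH p (+ 0) γ ≡ + 0

IsŜ : ℕ → ℕ → ℕ → List Step → Set
IsŜ p n j γ = (length γ ≡ n × endHeight p (- + j) γ ≡ + 0) × maxH p (- + j) γ ≡ + 0

allPaths : ℕ → List (List Step)
allPaths zero    = [] ∷ []
allPaths (suc n) = map (up ∷_) (allPaths n) ++ map (down ∷_) (allPaths n)

Rlist : ℕ → ℕ → ℕ → List (List Step)
Rlist p n j = filter (λ γ → endHeight p (+ 0) γ ℤ.≟ + j) (allPaths n)

Slist : ℕ → ℕ → ℕ → List (List Step)
Slist p n j = filter (λ γ → (endHeight p (+ 0) γ ℤ.≟ + j) ×-dec (minH p (+ 0) γ ℤ.≟ + 0)) (allPaths n)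

Ŝlist : ℕ → ℕ → ℕ → List (List Step)
Ŝlist p n j = filter (λ γ → (endHeight p (- + j) γ ℤ.≟ + 0) ×-dec (maxH p (- + j) γ ℤ.≟ + 0)) (allPaths n)

Rpoly Spoly Tpoly : ℕ → ℕ → ℕ → Poly
Rpoly p n j = map (weight p (+ 0)) (Rlist p n j)
Spoly p n j = map (weight p (+ 0)) (Slist p n j)
Tpoly p n j = map (weight p (- + j)) (Ŝlist p n j)

reflect : ℕ → ℕ × ℤ → ℕ × ℤ
reflect n (x , y) = (n ℕ.∸ x , - y)

stepsOf : List (ℕ × ℤ) → List Step
stepsOf []              = []
stepsOf (v ∷ [])        = []
stepsOf (v ∷ w ∷ vs)    =
  (if does (proj₂ w ℤ.≟ proj₂ v ℤ.+ + 1) then up else down) ∷ stepsOf (w ∷ vs)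

hat : ℕ → ℕ → List Step → List Step
hat p n γ = stepsOf (reverse (map (reflect n) (vertices p 0 (+ 0) γ)))

{-# OPTIONS --safe #-}
-- A path in 𝓢 starts with p upsteps and, if it ends at 0, ends with a downstep, since
-- otherwise it would go below 0. A path of length m(p+1)+j rising by j has exactly m
-- downsteps and j+pm upsteps, and the weight index k of a downstep is a height of the path,
-- with k+p a height too; bounding the heights gives the degrees and variable ranges.
-- For such paths γ̂ is the reversed step sequence, which reverses and negates the heights
-- and turns each weight index k into -p-k; so hat is a bijection 𝓢 → 𝓢̂, and T = S(a_{-p-k})
-- follows by reindexing the sum over all step sequences by reversal. Paths in 𝓡 are
-- counted by the positions of their downsteps. The number c(k,j) of paths in
-- 𝓢_[k(p+1)+j, j] satisfies c(k+1,0) = c(k,p) and c(k+1,j+1) = c(k+1,j) + c(k,j+1+p)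
-- (remove the last step), and so does the claimed formula, by the absorption identities
-- k·C(n,k) = n·C(n-1,k-1) and (n-k)·C(n,k) = n·C(n-1,k).
module Submission where

open import Defs
open import Data.Bool using (true; false; if_then_else_)
open import Data.Nat as ℕ using (ℕ; zero; suc; _*_; _+_; _∸_; _≤_; z≤n; s≤s; _!; NonZero)
open import Data.Nat.Combinatorics using (_C_; nCn≡1; nCk+nC[k+1]≡[n+1]C[k+1])
import Data.Nat.Properties as ℕP
open import Data.Integer as ℤ using (ℤ; +_; -_; -[1+_]; _⊓_; _⊔_)
import Data.Integer.Properties as ℤP
open import Data.Integer.Tactic.RingSolver using (solve-∀)
import Data.Nat.Tactic.RingSolver as NS
open import Data.Product using (_×_; _,_; ∃-syntax; proj₁; proj₂)
open import Data.List
  using (List; []; _∷_; _++_; _∷ʳ_; map; take; replicate; reverse; length; foldr; filter; initLast; _∷ʳ′_)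
open import Data.List.Membership.Propositional using (_∈_)
import Data.List.Properties as LP
open import Data.List.Relation.Unary.All as All using (All; []; _∷_)
import Data.List.Relation.Unary.All.Properties as AllP
open import Data.List.Relation.Unary.Any using (here; there)
import Data.List.Relation.Unary.Any.Properties as AnyP
open import Relation.Binary.PropositionalEquality
  using (_≡_; _≢_; refl; sym; trans; cong; cong₂; subst; module ≡-Reasoning)
open import Algebra.Bundles using (CommutativeSemiring)
open import Function using (_∘_; id)
open import Level using (0ℓ)
open import Relation.Unary using (Pred; Decidable)
open import Relation.Nullary using (Dec; yes; no; does; ¬_)
open import Relation.Nullary.Decidable using (_×-dec_; dec-true; dec-false; does-⇔)
open import Function.Bundles using (_⇔_; mk⇔)
open import Data.Empty using (⊥-elim)

-- Heights

heights : ℕ → ℤ → List Step → List ℤ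
heights p h []      = h ∷ []
heights p h (s ∷ γ) = h ∷ heights p (stepH p h s) γ

map-proj₂-vertices : ∀ p x h γ → map proj₂ (vertices p x h γ) ≡ heights p h γ
map-proj₂-vertices p x h []      = refl
map-proj₂-vertices p x h (s ∷ γ) = cong (h ∷_) (map-proj₂-vertices p (suc x) (stepH p h s) γ)

head-heights : ∀ {P : ℤ → Set} {p h} γ → All P (heights p h γ) → P h
head-heights []      (ph ∷ _) = ph
head-heights (s ∷ γ) (ph ∷ _) = ph

endHeight∈heights : ∀ p h γ → endHeight p h γ ∈ heights p h γ
endHeight∈heights p h []      = here refl
endHeight∈heights p h (s ∷ γ) = there (endHeight∈heights p (stepH p h s) γ)

endHeight-++ : ∀ p h γ δ → endHeight p h (γ ++ δ) ≡ endHeight p (endHeight p h γ) δ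
endHeight-++ p h []      δ = refl
endHeight-++ p h (s ∷ γ) δ = endHeight-++ p (stepH p h s) γ δ

unstep : ℕ → ℤ → Step → ℤ
unstep p h up   = h ℤ.- + 1
unstep p h down = h ℤ.+ + p

unstep-stepH : ∀ p h s → unstep p (stepH p h s) s ≡ h
unstep-stepH p h up   = cancel h (+ 1)
  where
  cancel : ∀ (h c : ℤ) → h ℤ.+ c ℤ.- c ≡ h
  cancel = solve-∀
unstep-stepH p h down = cancel h (+ p)
  where
  cancel : ∀ (h c : ℤ) → h ℤ.- c ℤ.+ c ≡ h
  cancel = solve-∀

stepH-injective : ∀ p s {x y} → stepH p x s ≡ stepH p y s → x ≡ y
stepH-injective p s {x} {y} eq =
  trans (sym (unstep-stepH p x s)) (trans (cong (λ z → unstep p z s) eq) (unstep-stepH p y s))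

endHeight-∷ʳ : ∀ p h γ s → endHeight p h (γ ∷ʳ s) ≡ stepH p (endHeight p h γ) s
endHeight-∷ʳ p h γ s = endHeight-++ p h γ (s ∷ [])

heights-∷ʳ : ∀ p h γ s → heights p h (γ ∷ʳ s) ≡ heights p h γ ∷ʳ stepH p (endHeight p h γ) s
heights-∷ʳ p h []      s = refl
heights-∷ʳ p h (t ∷ γ) s = cong (h ∷_) (heights-∷ʳ p (stepH p h t) γ s)

vertices-∷ʳ : ∀ p x h γ s → vertices p x h (γ ∷ʳ s) ≡
              vertices p x h γ ∷ʳ (length γ + suc x , stepH p (endHeight p h γ) s)
vertices-∷ʳ p x h []      s = refl
vertices-∷ʳ p x h (t ∷ γ) s = cong ((x , h) ∷_) (begin
  vertices p (suc x) h′ (γ ∷ʳ s)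
    ≡⟨ vertices-∷ʳ p (suc x) h′ γ s ⟩
  vertices p (suc x) h′ γ ∷ʳ (length γ + suc (suc x) , e)
    ≡⟨ cong (λ z → vertices p (suc x) h′ γ ∷ʳ (z , e)) (ℕP.+-suc (length γ) (suc x)) ⟩
  vertices p (suc x) h′ γ ∷ʳ (suc (length γ + suc x) , e) ∎)
  where
  open ≡-Reasoning
  h′ = stepH p h t
  e  = stepH p (endHeight p h′ γ) s

weight-++ : ∀ p h γ δ → weight p h (γ ++ δ) ≡ weight p h γ ++ weight p (endHeight p h γ) δ
weight-++ p h []         δ = refl
weight-++ p h (up ∷ γ)   δ = weight-++ p (stepH p h up) γ δ
weight-++ p h (down ∷ γ) δ = cong (h ℤ.- + p ∷_) (weight-++ p (stepH p h down) γ δ)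

foldr-⊓-≤ : ∀ h xs → All (foldr _⊓_ h xs ℤ.≤_) xs
foldr-⊓-≤ h []       = []
foldr-⊓-≤ h (x ∷ xs) = ℤP.i⊓j≤i x _ ∷ All.map (ℤP.≤-trans (ℤP.i⊓j≤j x _)) (foldr-⊓-≤ h xs)

≤-foldr-⊓ : ∀ {c h xs} → c ℤ.≤ h → All (c ℤ.≤_) xs → c ℤ.≤ foldr _⊓_ h xs
≤-foldr-⊓ c≤h []         = c≤h
≤-foldr-⊓ c≤h (c≤x ∷ cs) = ℤP.⊓-glb c≤x (≤-foldr-⊓ c≤h cs)

≤-foldr-⊔ : ∀ h xs → All (ℤ._≤ foldr _⊔_ h xs) xs
≤-foldr-⊔ h []       = []
≤-foldr-⊔ h (x ∷ xs) = ℤP.i≤i⊔j x _ ∷ All.map (λ le → ℤP.≤-trans le (ℤP.i≤j⊔i x _)) (≤-foldr-⊔ h xs)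

foldr-⊔-≤ : ∀ {c h xs} → h ℤ.≤ c → All (ℤ._≤ c) xs → foldr _⊔_ h xs ℤ.≤ c
foldr-⊔-≤ h≤c []         = h≤c
foldr-⊔-≤ h≤c (x≤c ∷ cs) = ℤP.⊔-lub x≤c (foldr-⊔-≤ h≤c cs)

minH≡foldr : ∀ p h γ → minH p h γ ≡ foldr _⊓_ h (heights p h γ)
minH≡foldr p h γ = cong (foldr _⊓_ h) (map-proj₂-vertices p 0 h γ)

maxH≡foldr : ∀ p h γ → maxH p h γ ≡ foldr _⊔_ h (heights p h γ)
maxH≡foldr p h γ = cong (foldr _⊔_ h) (map-proj₂-vertices p 0 h γ)

Nonnegative : ℕ → ℤ → List Step → Set
Nonnegative p h γ = All (+ 0 ℤ.≤_) (heights p h γ)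

Nonpositive : ℕ → ℤ → List Step → Set
Nonpositive p h γ = All (ℤ._≤ + 0) (heights p h γ)

minH≡0⇒nonnegative : ∀ p γ → minH p (+ 0) γ ≡ + 0 → Nonnegative p (+ 0) γ
minH≡0⇒nonnegative p γ min≡0 =
  subst (λ c → All (c ℤ.≤_) (heights p (+ 0) γ)) (trans (sym (minH≡foldr p (+ 0) γ)) min≡0)
        (foldr-⊓-≤ (+ 0) (heights p (+ 0) γ))

nonnegative⇒minH≡0 : ∀ p γ → Nonnegative p (+ 0) γ → minH p (+ 0) γ ≡ + 0
nonnegative⇒minH≡0 p γ nonneg = trans (minH≡foldr p (+ 0) γ) (ℤP.≤-antisym
  (head-heights γ (foldr-⊓-≤ (+ 0) (heights p (+ 0) γ)))
  (≤-foldr-⊓ ℤP.≤-refl nonneg))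

maxH≡0⇒nonpositive : ∀ p h γ → maxH p h γ ≡ + 0 → Nonpositive p h γ
maxH≡0⇒nonpositive p h γ max≡0 =
  subst (λ c → All (ℤ._≤ c) (heights p h γ)) (trans (sym (maxH≡foldr p h γ)) max≡0)
        (≤-foldr-⊔ h (heights p h γ))

nonpositive⇒maxH≡0 : ∀ p h γ → endHeight p h γ ≡ + 0 → Nonpositive p h γ → maxH p h γ ≡ + 0
nonpositive⇒maxH≡0 p h γ end≡0 nonpos = trans (maxH≡foldr p h γ) (ℤP.≤-antisym
  (foldr-⊔-≤ (head-heights γ nonpos) nonpos)
  (subst (ℤ._≤ foldr _⊔_ h (heights p h γ)) end≡0
         (All.lookup (≤-foldr-⊔ h (heights p h γ)) (endHeight∈heights p h γ))))

nonnegative-endHeight : ∀ p h γ → Nonnegative p h γ → + 0 ℤ.≤ endHeight p h γ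
nonnegative-endHeight p h γ nonneg = All.lookup nonneg (endHeight∈heights p h γ)

nonnegative-∷ʳ⁻ : ∀ p h γ s → Nonnegative p h (γ ∷ʳ s) →
                  Nonnegative p h γ × + 0 ℤ.≤ stepH p (endHeight p h γ) s
nonnegative-∷ʳ⁻ p h γ s nonneg = AllP.∷ʳ⁻ (subst (All _) (heights-∷ʳ p h γ s) nonneg)

nonnegative-∷ʳ⁺ : ∀ p h γ s → Nonnegative p h γ → + 0 ℤ.≤ stepH p (endHeight p h γ) s →
                  Nonnegative p h (γ ∷ʳ s)
nonnegative-∷ʳ⁺ p h γ s nonneg last = subst (All _) (sym (heights-∷ʳ p h γ s)) (AllP.∷ʳ⁺ nonneg last)

-- Up- and downsteps

ups downs : List Step → ℕ
ups []         = 0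
ups (up ∷ γ)   = suc (ups γ)
ups (down ∷ γ) = ups γ
downs []         = 0
downs (up ∷ γ)   = downs γ
downs (down ∷ γ) = suc (downs γ)

ups+downs≡length : ∀ γ → ups γ + downs γ ≡ length γ
ups+downs≡length []         = refl
ups+downs≡length (up ∷ γ)   = cong suc (ups+downs≡length γ)
ups+downs≡length (down ∷ γ) = trans (ℕP.+-suc (ups γ) (downs γ)) (cong suc (ups+downs≡length γ))

length-weight : ∀ p h γ → length (weight p h γ) ≡ downs γ
length-weight p h []         = refl
length-weight p h (up ∷ γ)   = length-weight p (stepH p h up) γ
length-weight p h (down ∷ γ) = cong suc (length-weight p (stepH p h down) γ)

pos-*-suc : ∀ p d → + (p * suc d) ≡ + p ℤ.+ + (p * d)
pos-*-suc p d = trans (cong +_ (ℕP.*-suc p d)) (ℤP.pos-+ p (p * d))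

endHeight≡ : ∀ p h γ → endHeight p h γ ≡ h ℤ.+ + ups γ ℤ.- + (p * downs γ)
endHeight≡ p h [] = sym (trans (cong (λ z → h ℤ.+ + 0 ℤ.- + z) (ℕP.*-zeroʳ p))
                              (trans (ℤP.+-identityʳ _) (ℤP.+-identityʳ h)))
endHeight≡ p h (up ∷ γ) = trans (endHeight≡ p (stepH p h up) γ) (shift h (+ ups γ) _)
  where
  shift : ∀ (h u d : ℤ) → h ℤ.+ + 1 ℤ.+ u ℤ.- d ≡ h ℤ.+ (+ 1 ℤ.+ u) ℤ.- d
  shift = solve-∀
endHeight≡ p h (down ∷ γ) = trans (endHeight≡ p (stepH p h down) γ)
  (trans (shift h (+ ups γ) (+ p) _) (cong (λ z → h ℤ.+ + ups γ ℤ.- z) (sym (pos-*-suc p (downs γ)))))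
  where
  shift : ∀ (h u q d : ℤ) → h ℤ.- q ℤ.+ u ℤ.- d ≡ h ℤ.+ u ℤ.- (q ℤ.+ d)
  shift = solve-∀

head∈heights : ∀ p h γ → h ∈ heights p h γ
head∈heights p h []      = here refl
head∈heights p h (s ∷ γ) = here refl

heights-between : ∀ p h γ →
  All (Between (h ℤ.- + (p * downs γ)) (h ℤ.+ + ups γ)) (heights p h γ)
heights-between p h [] = (ℤP.i-j≤i h (+ (p * 0)) , ℤP.i≤i+j h (+ 0)) ∷ []
heights-between p h (up ∷ γ) =
  (ℤP.i-j≤i h _ , ℤP.i≤i+j h (+ suc (ups γ)))
  ∷ All.map (λ (l , u) → ℤP.≤-trans (ℤP.+-monoˡ-≤ _ (ℤP.i≤i+j h (+ 1))) l
                       , ℤP.≤-trans u (ℤP.≤-reflexive (ℤP.+-assoc h (+ 1) (+ ups γ))))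
            (heights-between p (stepH p h up) γ)
heights-between p h (down ∷ γ) =
  (ℤP.i-j≤i h _ , ℤP.i≤i+j h (+ ups γ))
  ∷ All.map (λ (l , u) → ℤP.≤-trans (ℤP.≤-reflexive lower≡) l
                       , ℤP.≤-trans u (ℤP.+-monoˡ-≤ (+ ups γ) (ℤP.i-j≤i h (+ p))))
            (heights-between p (stepH p h down) γ)
  where
  regroup : ∀ (h q d : ℤ) → h ℤ.- (q ℤ.+ d) ≡ h ℤ.- q ℤ.- d
  regroup = solve-∀
  lower≡ : h ℤ.- + (p * suc (downs γ)) ≡ h ℤ.- + p ℤ.- + (p * downs γ)
  lower≡ = trans (cong (λ z → h ℤ.- z) (pos-*-suc p (downs γ))) (regroup h (+ p) _)

weight⊆heights : ∀ p h γ →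
  All (λ k → k ∈ heights p h γ × k ℤ.+ + p ∈ heights p h γ) (weight p h γ)
weight⊆heights p h [] = []
weight⊆heights p h (up ∷ γ) =
  All.map (λ (k∈ , k+p∈) → there k∈ , there k+p∈) (weight⊆heights p (stepH p h up) γ)
weight⊆heights p h (down ∷ γ) =
  (there (head∈heights p (h ℤ.- + p) γ) , here (cancel h (+ p)))
  ∷ All.map (λ (k∈ , k+p∈) → there k∈ , there k+p∈) (weight⊆heights p (stepH p h down) γ)
  where
  cancel : ∀ (h q : ℤ) → h ℤ.- q ℤ.+ q ≡ h
  cancel = solve-∀

≤-moveʳ : ∀ {k x : ℤ} q → k ℤ.+ q ℤ.≤ x → k ℤ.≤ x ℤ.- q
≤-moveʳ {k} {x} q k+q≤x = subst (ℤ._≤ x ℤ.- q) (cancel k q) (ℤP.+-monoˡ-≤ (ℤ.- q) k+q≤x)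
  where
  cancel : ∀ (k q : ℤ) → k ℤ.+ q ℤ.- q ≡ k
  cancel = solve-∀

weight-between : ∀ p h γ →
  All (Between (h ℤ.- + (p * downs γ)) (h ℤ.+ + ups γ ℤ.- + p)) (weight p h γ)
weight-between p h γ = All.map
  (λ (k∈ , k+p∈) → proj₁ (All.lookup bounds k∈) , ≤-moveʳ (+ p) (proj₂ (All.lookup bounds k+p∈)))
  (weight⊆heights p h γ)
  where bounds = heights-between p h γ

nonnegative-weight : ∀ p h γ → Nonnegative p h γ → All (+ 0 ℤ.≤_) (weight p h γ)
nonnegative-weight p h γ nonneg = All.map (All.lookup nonneg ∘ proj₁) (weight⊆heights p h γ)

nonpositive-weight : ∀ p h γ → Nonpositive p h γ → All (ℤ._≤ - + p) (weight p h γ)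
nonpositive-weight p h γ nonpos = All.map
  (λ (_ , k+p∈) → subst (_ ℤ.≤_) (ℤP.+-identityˡ (- + p)) (≤-moveʳ (+ p) (All.lookup nonpos k+p∈)))
  (weight⊆heights p h γ)

ups≡ : ∀ p j h γ → endHeight p h γ ≡ h ℤ.+ + j → ups γ ≡ j + p * downs γ
ups≡ p j h γ end≡ = ℤP.+-injective (begin
  + ups γ                               ≡⟨ isolate h (+ ups γ) (+ (p * downs γ)) ⟩
  (h ℤ.+ + ups γ ℤ.- + (p * downs γ)) ℤ.- h ℤ.+ + (p * downs γ)
    ≡⟨ cong (λ e → e ℤ.- h ℤ.+ + (p * downs γ)) (trans (sym (endHeight≡ p h γ)) end≡) ⟩
  (h ℤ.+ + j) ℤ.- h ℤ.+ + (p * downs γ) ≡⟨ cong (ℤ._+ + (p * downs γ)) (cancel h (+ j)) ⟩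
  + j ℤ.+ + (p * downs γ)               ≡⟨ ℤP.pos-+ j (p * downs γ) ⟨
  + (j + p * downs γ)                   ∎)
  where
  open ≡-Reasoning
  isolate : ∀ (h u x : ℤ) → u ≡ (h ℤ.+ u ℤ.- x) ℤ.- h ℤ.+ x
  isolate = solve-∀
  cancel : ∀ (h j : ℤ) → h ℤ.+ j ℤ.- h ≡ j
  cancel = solve-∀

downs≡ : ∀ p m j h γ → length γ ≡ m * suc p + j → endHeight p h γ ≡ h ℤ.+ + j → downs γ ≡ m
downs≡ p m j h γ len end≡ = ℕP.*-cancelʳ-≡ (downs γ) m (suc p) (ℕP.+-cancelʳ-≡ j _ _ (begin
  downs γ * suc p + j           ≡⟨ regroup (downs γ) p j ⟩
  (j + p * downs γ) + downs γ  ≡⟨ cong (_+ downs γ) (ups≡ p j h γ end≡) ⟨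
  ups γ + downs γ              ≡⟨ ups+downs≡length γ ⟩
  length γ                     ≡⟨ len ⟩
  m * suc p + j                ∎))
  where
  open ≡-Reasoning
  regroup : ∀ d p j → d * suc p + j ≡ (j + p * d) + d
  regroup = NS.solve-∀

HomogeneousMonomial : ℕ → (ℤ → Set) → Monomial → Set
HomogeneousMonomial d V μ = length μ ≡ d × All V μ

Between-mono : ∀ {lo lo′ hi hi′} → lo′ ℤ.≤ lo → hi ℤ.≤ hi′ →
               ∀ {k} → Between lo hi k → Between lo′ hi′ k
Between-mono lo′≤lo hi≤hi′ (lo≤k , k≤hi) = ℤP.≤-trans lo′≤lo lo≤k , ℤP.≤-trans k≤hi hi≤hi′

weight-homogeneous : ∀ p m j h γ → length γ ≡ m * suc p + j → endHeight p h γ ≡ h ℤ.+ + j →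
  HomogeneousMonomial m (Between (h ℤ.- + (p * m)) (h ℤ.+ + (j + p * m) ℤ.- + p)) (weight p h γ)
weight-homogeneous p m j h γ len end≡ =
  trans (length-weight p h γ) downs≡m ,
  subst (λ d → All (Between (h ℤ.- + (p * d)) (h ℤ.+ + (j + p * d) ℤ.- + p)) (weight p h γ)) downs≡m
        (subst (λ u → All (Between (h ℤ.- + (p * downs γ)) (h ℤ.+ + u ℤ.- + p)) (weight p h γ))
               (ups≡ p j h γ end≡)
               (weight-between p h γ))
  where downs≡m = downs≡ p m j h γ len end≡

pos-+-cancel : ∀ a b → + (a + b) ℤ.- + b ≡ + a
pos-+-cancel a b = trans (cong (ℤ._- + b) (ℤP.pos-+ a b)) (cancel (+ a) (+ b))
  where
  cancel : ∀ (a b : ℤ) → a ℤ.+ b ℤ.- b ≡ a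
  cancel = solve-∀

R-weight-homogeneous : ∀ p m j {γ} → 1 ≤ m → IsR p (m * suc p + j) j γ →
  HomogeneousMonomial m (Between (- (+ (m * p))) (+ ((m ∸ 1) * p + j))) (weight p (+ 0) γ)
R-weight-homogeneous p m@(suc m′) j {γ} _ (len , end≡) =
  let (deg , between) = weight-homogeneous p m j (+ 0) γ len (trans end≡ (sym (ℤP.+-identityˡ (+ j))))
  in deg , All.map (Between-mono (ℤP.≤-reflexive lower≡) (ℤP.≤-reflexive upper≡)) between
  where
  lower≡ : - (+ (m * p)) ≡ + 0 ℤ.- + (p * m)
  lower≡ = trans (cong (λ z → - (+ z)) (ℕP.*-comm m p)) (sym (ℤP.+-identityˡ _))
  upper≡ : + 0 ℤ.+ + (j + p * m) ℤ.- + p ≡ + (m′ * p + j)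
  upper≡ = begin
    + 0 ℤ.+ + (j + p * m) ℤ.- + p ≡⟨ cong (ℤ._- + p) (ℤP.+-identityˡ (+ (j + p * m))) ⟩
    + (j + p * m) ℤ.- + p          ≡⟨ cong (λ z → + z ℤ.- + p) (regroup j p m′) ⟩
    + (m′ * p + j + p) ℤ.- + p     ≡⟨ pos-+-cancel (m′ * p + j) p ⟩
    + (m′ * p + j)                 ∎
    where
    open ≡-Reasoning
    regroup : ∀ j p m′ → j + p * suc m′ ≡ m′ * p + j + p
    regroup = NS.solve-∀

S-weight-homogeneous : ∀ p m j {γ} → 1 ≤ m → IsS p (m * suc p + j) j γ →
  HomogeneousMonomial m (Between (+ 0) (+ ((m ∸ 1) * p + j))) (weight p (+ 0) γ)
S-weight-homogeneous p m j {γ} 1≤m (isR , min≡0) =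
  let (deg , between) = R-weight-homogeneous p m j {γ} 1≤m isR
  in deg , All.zipWith (λ (0≤k , (_ , k≤hi)) → 0≤k , k≤hi)
                       (nonnegative-weight p (+ 0) γ (minH≡0⇒nonnegative p γ min≡0) , between)

T-weight-homogeneous : ∀ p m j {γ} → IsŜ p (m * suc p + j) j γ →
  HomogeneousMonomial m (Between (- (+ (j + m * p))) (- (+ p))) (weight p (- + j) γ)
T-weight-homogeneous p m j {γ} ((len , end≡0) , max≡0) =
  let (deg , between) = weight-homogeneous p m j (- + j) γ len
                          (trans end≡0 (sym (ℤP.+-inverseˡ (+ j))))
  in deg , All.zipWith (λ ((lo≤k , _) , k≤-p) → ℤP.≤-trans (ℤP.≤-reflexive lower≡) lo≤k , k≤-p)
                       (between , nonpositive-weight p (- + j) γ (maxH≡0⇒nonpositive p (- + j) γ max≡0))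
  where
  regroup : ∀ (a b : ℤ) → - (a ℤ.+ b) ≡ - a ℤ.- b
  regroup = solve-∀
  lower≡ : - (+ (j + m * p)) ≡ - + j ℤ.- + (p * m)
  lower≡ = trans (cong (λ z → - + (j + z)) (ℕP.*-comm m p))
                 (trans (cong -_ (ℤP.pos-+ j (p * m))) (regroup (+ j) (+ (p * m))))

-- Path families

allPaths-length : ∀ n → All (λ γ → length γ ≡ n) (allPaths n)
allPaths-length zero    = refl ∷ []
allPaths-length (suc n) = AllP.++⁺ (AllP.map⁺ (All.map (cong suc) (allPaths-length n)))
                                   (AllP.map⁺ (All.map (cong suc) (allPaths-length n)))

filter-allPaths : ∀ {P : Pred (List Step) 0ℓ} (P? : Decidable P) n →
                  All (λ γ → length γ ≡ n × P γ) (filter P? (allPaths n))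
filter-allPaths P? n = All.zipWith id (AllP.filter⁺ P? (allPaths-length n) , AllP.all-filter P? (allPaths n))

Ballot : ℕ → ℕ → List Step → Set
Ballot p j γ = endHeight p (+ 0) γ ≡ + j × minH p (+ 0) γ ≡ + 0

ballot? : ∀ p j → Decidable (Ballot p j)
ballot? p j γ = (endHeight p (+ 0) γ ℤ.≟ + j) ×-dec (minH p (+ 0) γ ℤ.≟ + 0)

Coballot : ℕ → ℕ → List Step → Set
Coballot p j γ = endHeight p (- + j) γ ≡ + 0 × maxH p (- + j) γ ≡ + 0

coballot? : ∀ p j → Decidable (Coballot p j)
coballot? p j γ = (endHeight p (- + j) γ ℤ.≟ + 0) ×-dec (maxH p (- + j) γ ℤ.≟ + 0)

Rlist-IsR : ∀ p n j → All (IsR p n j) (Rlist p n j)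
Rlist-IsR p n j = filter-allPaths (λ γ → endHeight p (+ 0) γ ℤ.≟ + j) n

Slist-IsS : ∀ p n j → All (IsS p n j) (Slist p n j)
Slist-IsS p n j = All.map (λ (len , end , min) → (len , end) , min) (filter-allPaths (ballot? p j) n)

Ŝlist-IsŜ : ∀ p n j → All (IsŜ p n j) (Ŝlist p n j)
Ŝlist-IsŜ p n j = All.map (λ (len , end , max) → (len , end) , max) (filter-allPaths (coballot? p j) n)

Rpoly-homogeneous : ∀ p m j → 1 ≤ m →
  IsHomogeneous m (Between (- (+ (m * p))) (+ ((m ∸ 1) * p + j))) (Rpoly p (m * suc p + j) j)
Rpoly-homogeneous p m j 1≤m = AllP.map⁺ (All.map (λ {γ} → R-weight-homogeneous p m j {γ} 1≤m) (Rlist-IsR p _ j))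

Spoly-homogeneous : ∀ p m j → 1 ≤ m →
  IsHomogeneous m (Between (+ 0) (+ ((m ∸ 1) * p + j))) (Spoly p (m * suc p + j) j)
Spoly-homogeneous p m j 1≤m = AllP.map⁺ (All.map (λ {γ} → S-weight-homogeneous p m j {γ} 1≤m) (Slist-IsS p _ j))

Tpoly-homogeneous : ∀ p m j →
  IsHomogeneous m (Between (- (+ (j + m * p))) (- (+ p))) (Tpoly p (m * suc p + j) j)
Tpoly-homogeneous p m j = AllP.map⁺ (All.map (λ {γ} → T-weight-homogeneous p m j {γ}) (Ŝlist-IsŜ p _ j))

0≤m-n⇒n≤m : ∀ {m n} → + 0 ℤ.≤ + m ℤ.- + n → n ≤ m
0≤m-n⇒n≤m 0≤m-n = ℤP.drop‿+≤+ (ℤP.0≤i-j⇒j≤i 0≤m-n)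

nonnegative⇒take-up : ∀ p i h γ → h + i ≤ p → i ≤ length γ → Nonnegative p (+ h) γ →
                       take i γ ≡ replicate i up
nonnegative⇒take-up p zero    h γ          _   _         _ = refl
nonnegative⇒take-up p (suc i) h (up ∷ γ)   h+i≤p (s≤s i≤n) (_ ∷ nonneg) =
  cong (up ∷_) (nonnegative⇒take-up p i (h + 1) γ (subst (_≤ p) (sym (ℕP.+-assoc h 1 i)) h+i≤p) i≤n nonneg)
nonnegative⇒take-up p (suc i) h (down ∷ γ) h+i≤p _         (_ ∷ nonneg) =
  ⊥-elim (ℕP.<⇒≱ h<p (0≤m-n⇒n≤m (head-heights γ nonneg)))
  where
  h<p : h ℕ.< p
  h<p = ℕP.≤-trans (s≤s (ℕP.m≤m+n h i)) (subst (_≤ p) (ℕP.+-suc h i) h+i≤p)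

Ballot⇒nonnegative : ∀ {p j γ} → Ballot p j γ → Nonnegative p (+ 0) γ
Ballot⇒nonnegative {p} {γ = γ} (_ , min≡0) = minH≡0⇒nonnegative p γ min≡0

Ballot-∷ʳ⁻ : ∀ {p e x} γ s → stepH p x s ≡ + e → Ballot p e (γ ∷ʳ s) →
             endHeight p (+ 0) γ ≡ x × Nonnegative p (+ 0) γ
Ballot-∷ʳ⁻ {p} γ s step≡e ballot@(end≡e , _) =
  stepH-injective p s (trans (sym (endHeight-∷ʳ p (+ 0) γ s)) (trans end≡e (sym step≡e))) ,
  proj₁ (nonnegative-∷ʳ⁻ p (+ 0) γ s (Ballot⇒nonnegative ballot))

Ballot-∷ʳ : ∀ p e e′ γ s → stepH p (+ e′) s ≡ + e → Ballot p e (γ ∷ʳ s) ⇔ Ballot p e′ γ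
Ballot-∷ʳ p e e′ γ s step≡e = mk⇔
  (λ ballot → let (end≡e′ , nonneg) = Ballot-∷ʳ⁻ γ s step≡e ballot
              in end≡e′ , nonnegative⇒minH≡0 p γ nonneg)
  (λ (end≡e′ , min≡0) →
     let end-∷ʳ≡e = trans (endHeight-∷ʳ p (+ 0) γ s) (trans (cong (λ x → stepH p x s) end≡e′) step≡e)
     in end-∷ʳ≡e ,
        nonnegative⇒minH≡0 p (γ ∷ʳ s)
          (nonnegative-∷ʳ⁺ p (+ 0) γ s (minH≡0⇒nonnegative p γ min≡0)
            (subst (+ 0 ℤ.≤_) (trans (sym end-∷ʳ≡e) (endHeight-∷ʳ p (+ 0) γ s)) (ℤ.+≤+ z≤n))))

¬Ballot-0-∷ʳ-up : ∀ p γ → ¬ Ballot p 0 (γ ∷ʳ up)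
¬Ballot-0-∷ʳ-up p γ ballot =
  let (end≡-1 , nonneg) = Ballot-∷ʳ⁻ {x = -[1+ 0 ]} γ up refl ballot
  in ℤP.<⇒≱ ℤ.-<+ (subst (+ 0 ℤ.≤_) end≡-1 (nonnegative-endHeight p (+ 0) γ nonneg))

S-last-step : ∀ p n γ → 1 ≤ n → IsS p n 0 γ → ∃[ δ ] (γ ≡ δ ++ (down ∷ []) × endHeight p (+ 0) δ ≡ + p)
S-last-step p n γ 1≤n isS with initLast γ
S-last-step p n .[] 1≤n ((len , _) , _) | [] with () ← subst (1 ≤_) (sym len) 1≤n
S-last-step p n .(δ ∷ʳ up) _ ((_ , end≡0) , min≡0) | δ ∷ʳ′ up =
  ⊥-elim (¬Ballot-0-∷ʳ-up p δ (end≡0 , min≡0))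
S-last-step p n .(δ ∷ʳ down) _ ((_ , end≡0) , min≡0) | δ ∷ʳ′ down =
  δ , refl , proj₁ (Ballot-∷ʳ⁻ δ down (ℤP.+-inverseʳ (+ p)) (end≡0 , min≡0))

-- Reversal

stepH-reverse : ∀ p h s → stepH p (- stepH p h s) s ≡ - h
stepH-reverse p h up   = negate h
  where
  negate : ∀ (h : ℤ) → - (h ℤ.+ + 1) ℤ.+ + 1 ≡ - h
  negate = solve-∀
stepH-reverse p h down = negate h (+ p)
  where
  negate : ∀ (h q : ℤ) → - (h ℤ.- q) ℤ.- q ≡ - h
  negate = solve-∀

endHeight-reverse : ∀ p h γ → endHeight p (- endHeight p h γ) (reverse γ) ≡ - h
endHeight-reverse p h []      = refl
endHeight-reverse p h (s ∷ γ) = begin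
  endHeight p (- e) (reverse (s ∷ γ))     ≡⟨ cong (endHeight p (- e)) (LP.unfold-reverse s γ) ⟩
  endHeight p (- e) (reverse γ ∷ʳ s)      ≡⟨ endHeight-∷ʳ p (- e) (reverse γ) s ⟩
  stepH p (endHeight p (- e) (reverse γ)) s ≡⟨ cong (λ z → stepH p z s) (endHeight-reverse p (stepH p h s) γ) ⟩
  stepH p (- stepH p h s) s               ≡⟨ stepH-reverse p h s ⟩
  - h                                     ∎
  where
  open ≡-Reasoning
  e = endHeight p (stepH p h s) γ

heights-reverse : ∀ p h γ → heights p (- endHeight p h γ) (reverse γ) ≡ reverse (map -_ (heights p h γ))
heights-reverse p h []      = refl
heights-reverse p h (s ∷ γ) = begin
  heights p (- e) (reverse (s ∷ γ))  ≡⟨ cong (heights p (- e)) (LP.unfold-reverse s γ) ⟩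
  heights p (- e) (reverse γ ∷ʳ s)   ≡⟨ heights-∷ʳ p (- e) (reverse γ) s ⟩
  heights p (- e) (reverse γ) ∷ʳ stepH p (endHeight p (- e) (reverse γ)) s
    ≡⟨ cong₂ _∷ʳ_ (heights-reverse p (stepH p h s) γ)
                  (trans (cong (λ z → stepH p z s) (endHeight-reverse p (stepH p h s) γ)) (stepH-reverse p h s)) ⟩
  reverse (map -_ (heights p (stepH p h s) γ)) ∷ʳ - h
    ≡⟨ LP.unfold-reverse (- h) (map -_ (heights p (stepH p h s) γ)) ⟨
  reverse (map -_ (heights p h (s ∷ γ))) ∎
  where
  open ≡-Reasoning
  e = endHeight p (stepH p h s) γ

mirror : ℕ → ℤ → ℤ
mirror p k = - (+ p) ℤ.- k

weight-reverse : ∀ p h γ →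
  weight p (- endHeight p h γ) (reverse γ) ≡ reverse (map (mirror p) (weight p h γ))
weight-reverse p h []      = refl
weight-reverse p h (s ∷ γ) = begin
  weight p (- e) (reverse (s ∷ γ))  ≡⟨ cong (weight p (- e)) (LP.unfold-reverse s γ) ⟩
  weight p (- e) (reverse γ ∷ʳ s)   ≡⟨ weight-++ p (- e) (reverse γ) (s ∷ []) ⟩
  weight p (- e) (reverse γ) ++ weight p (endHeight p (- e) (reverse γ)) (s ∷ [])
    ≡⟨ cong₂ _++_ (weight-reverse p (stepH p h s) γ)
                  (cong (λ z → weight p z (s ∷ [])) (endHeight-reverse p (stepH p h s) γ)) ⟩
  reverse (map (mirror p) (weight p (stepH p h s) γ)) ++ weight p (- stepH p h s) (s ∷ [])
    ≡⟨ last-step s ⟩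
  reverse (map (mirror p) (weight p h (s ∷ γ))) ∎
  where
  open ≡-Reasoning
  e = endHeight p (stepH p h s) γ
  mirror-down : ∀ (h q : ℤ) → - (h ℤ.- q) ℤ.- q ≡ - q ℤ.- (h ℤ.- q)
  mirror-down = solve-∀
  last-step : ∀ s → reverse (map (mirror p) (weight p (stepH p h s) γ)) ++ weight p (- stepH p h s) (s ∷ []) ≡
                    reverse (map (mirror p) (weight p h (s ∷ γ)))
  last-step up   = LP.++-identityʳ _
  last-step down = trans (cong (reverse (map (mirror p) (weight p (stepH p h down) γ)) ∷ʳ_) (mirror-down h (+ p)))
                         (sym (LP.unfold-reverse (mirror p (h ℤ.- + p)) (map (mirror p) (weight p (stepH p h down) γ))))

reverse-reflect-vertices : ∀ p N x h γ → x + length γ ≡ N →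
  reverse (map (reflect N) (vertices p x h γ)) ≡ vertices p 0 (- endHeight p h γ) (reverse γ)
reverse-reflect-vertices p N x h [] x≡N =
  cong (λ z → (z , - h) ∷ []) (trans (cong (N ∸_) (trans (sym (ℕP.+-identityʳ x)) x≡N)) (ℕP.n∸n≡0 N))
reverse-reflect-vertices p N x h (s ∷ γ) x+n≡N = begin
  reverse (map (reflect N) (vertices p x h (s ∷ γ)))
    ≡⟨ LP.unfold-reverse (N ∸ x , - h) (map (reflect N) (vertices p (suc x) h′ γ)) ⟩
  reverse (map (reflect N) (vertices p (suc x) h′ γ)) ∷ʳ (N ∸ x , - h)
    ≡⟨ cong₂ _∷ʳ_ (reverse-reflect-vertices p N (suc x) h′ γ (trans (sym (ℕP.+-suc x (length γ))) x+n≡N))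
                  (cong₂ _,_ N∸x≡ (sym (trans (cong (λ z → stepH p z s) (endHeight-reverse p h′ γ))
                                              (stepH-reverse p h s)))) ⟩
  vertices p 0 (- e) (reverse γ) ∷ʳ (length (reverse γ) + 1 , stepH p (endHeight p (- e) (reverse γ)) s)
    ≡⟨ vertices-∷ʳ p 0 (- e) (reverse γ) s ⟨
  vertices p 0 (- e) (reverse γ ∷ʳ s)  ≡⟨ cong (vertices p 0 (- e)) (LP.unfold-reverse s γ) ⟨
  vertices p 0 (- e) (reverse (s ∷ γ)) ∎
  where
  open ≡-Reasoning
  h′ = stepH p h s
  e = endHeight p h′ γ
  N∸x≡ : N ∸ x ≡ length (reverse γ) + 1
  N∸x≡ = begin
    N ∸ x                  ≡⟨ cong (_∸ x) x+n≡N ⟨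
    x + suc (length γ) ∸ x ≡⟨ ℕP.m+n∸m≡n x (suc (length γ)) ⟩
    suc (length γ)         ≡⟨ ℕP.+-comm 1 (length γ) ⟩
    length γ + 1           ≡⟨ cong (_+ 1) (LP.length-reverse γ) ⟨
    length (reverse γ) + 1 ∎

stepH-down≢up : ∀ p h → stepH p h down ≢ stepH p h up
stepH-down≢up p h eq with trans (sym (cancel h (- + p))) (trans (cong (ℤ._- h) eq) (cancel h (+ 1)))
  where
  cancel : ∀ (h c : ℤ) → h ℤ.+ c ℤ.- h ≡ c
  cancel = solve-∀
stepH-down≢up zero    h eq | ()
stepH-down≢up (suc p) h eq | ()

read-step : ∀ p h s → (if does (stepH p h s ℤ.≟ h ℤ.+ + 1) then up else down) ≡ s
read-step p h up   rewrite dec-true (stepH p h up ℤ.≟ h ℤ.+ + 1) refl = refl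
read-step p h down rewrite dec-false (stepH p h down ℤ.≟ h ℤ.+ + 1) (stepH-down≢up p h) = refl

stepsOf-vertices : ∀ p x h γ → stepsOf (vertices p x h γ) ≡ γ
stepsOf-vertices p x h []          = refl
stepsOf-vertices p x h (s ∷ [])    = cong (_∷ []) (read-step p h s)
stepsOf-vertices p x h (s ∷ t ∷ γ) = cong₂ _∷_ (read-step p h s) (stepsOf-vertices p (suc x) (stepH p h s) (t ∷ γ))

hat≡reverse : ∀ p n γ → length γ ≡ n → hat p n γ ≡ reverse γ
hat≡reverse p n γ len = trans (cong stepsOf (reverse-reflect-vertices p n 0 (+ 0) γ len))
                              (stepsOf-vertices p 0 _ (reverse γ))

All-reverse⁺ : ∀ {A : Set} {P : A → Set} {xs} → All P xs → All P (reverse xs)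
All-reverse⁺ ps = All.tabulate (All.lookup ps ∘ AnyP.reverse⁻)

reverse-nonnegative : ∀ p h γ → Nonnegative p h γ → Nonpositive p (- endHeight p h γ) (reverse γ)
reverse-nonnegative p h γ nonneg = subst (All (ℤ._≤ + 0)) (sym (heights-reverse p h γ))
  (All-reverse⁺ (AllP.map⁺ (All.map ℤP.neg-mono-≤ nonneg)))

reverse-nonpositive : ∀ p h γ → Nonpositive p h γ → Nonnegative p (- endHeight p h γ) (reverse γ)
reverse-nonpositive p h γ nonpos = subst (All (+ 0 ℤ.≤_)) (sym (heights-reverse p h γ))
  (All-reverse⁺ (AllP.map⁺ (All.map ℤP.neg-mono-≤ nonpos)))

Ballot⇒Coballot-reverse : ∀ p j γ → Ballot p j γ → Coballot p j (reverse γ)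
Ballot⇒Coballot-reverse p j γ (end≡j , min≡0) =
  end≡0 , nonpositive⇒maxH≡0 p (- + j) (reverse γ) end≡0
            (subst (λ e → Nonpositive p (- e) (reverse γ)) end≡j
                   (reverse-nonnegative p (+ 0) γ (minH≡0⇒nonnegative p γ min≡0)))
  where
  end≡0 : endHeight p (- + j) (reverse γ) ≡ + 0
  end≡0 = subst (λ e → endHeight p (- e) (reverse γ) ≡ + 0) end≡j (endHeight-reverse p (+ 0) γ)

Coballot⇒Ballot-reverse : ∀ p j δ → Coballot p j δ → Ballot p j (reverse δ)
Coballot⇒Ballot-reverse p j δ (end≡0 , max≡0) =
  trans (subst (λ e → endHeight p (- e) (reverse δ) ≡ - - + j) end≡0 (endHeight-reverse p (- + j) δ))
        (ℤP.neg-involutive (+ j)) ,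
  nonnegative⇒minH≡0 p (reverse δ)
    (subst (λ e → Nonnegative p (- e) (reverse δ)) end≡0
           (reverse-nonpositive p (- + j) δ (maxH≡0⇒nonpositive p (- + j) δ max≡0)))

IsS⇒IsŜ-reverse : ∀ p n j γ → IsS p n j γ → IsŜ p n j (reverse γ)
IsS⇒IsŜ-reverse p n j γ ((len , end≡j) , min≡0) =
  let (end≡0 , max≡0) = Ballot⇒Coballot-reverse p j γ (end≡j , min≡0)
  in (trans (LP.length-reverse γ) len , end≡0) , max≡0

IsŜ⇒IsS-reverse : ∀ p n j δ → IsŜ p n j δ → IsS p n j (reverse δ)
IsŜ⇒IsS-reverse p n j δ ((len , end≡0) , max≡0) =
  let (end≡j , min≡0) = Coballot⇒Ballot-reverse p j δ (end≡0 , max≡0)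
  in (trans (LP.length-reverse δ) len , end≡j) , min≡0

hat-IsS : ∀ p n j γ → IsS p n j γ →
  vertices p 0 (- + j) (hat p n γ) ≡ reverse (map (reflect n) (vertices p 0 (+ 0) γ)) × IsŜ p n j (hat p n γ)
hat-IsS p n j γ isS@((len , end≡j) , _) rewrite hat≡reverse p n γ len =
  sym (subst (λ e → reverse (map (reflect n) (vertices p 0 (+ 0) γ)) ≡ vertices p 0 (- e) (reverse γ)) end≡j
             (reverse-reflect-vertices p n 0 (+ 0) γ len)) ,
  IsS⇒IsŜ-reverse p n j γ isS

hat-injective : ∀ p n j γ δ → IsS p n j γ → IsS p n j δ → hat p n γ ≡ hat p n δ → γ ≡ δ
hat-injective p n j γ δ ((len-γ , _) , _) ((len-δ , _) , _) hat≡ = LP.reverse-injective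
  (trans (sym (hat≡reverse p n γ len-γ)) (trans hat≡ (hat≡reverse p n δ len-δ)))

hat-surjective : ∀ p n j δ → IsŜ p n j δ → ∃[ γ ] (IsS p n j γ × hat p n γ ≡ δ)
hat-surjective p n j δ isŜ@((len , _) , _) =
  reverse δ , IsŜ⇒IsS-reverse p n j δ isŜ ,
  trans (hat≡reverse p n (reverse δ) (trans (LP.length-reverse δ) len)) (LP.reverse-involutive δ)

-- Sums over all paths

module Sums (R : CommutativeSemiring 0ℓ 0ℓ) where
  open CommutativeSemiring R
    renaming (_+_ to _⊕_; _*_ to _⊗_; refl to ≈-refl; sym to ≈-sym; trans to ≈-trans; reflexive to ≈-reflexive;
              setoid to ≈-setoid)
  open import Algebra.Properties.CommutativeSemigroup +-commutativeSemigroup using (interchange)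
  open import Relation.Binary.Reasoning.Setoid ≈-setoid

  Σ : ∀ {X : Set} → List X → (X → Carrier) → Carrier
  Σ []       f = 0#
  Σ (x ∷ xs) f = f x ⊕ Σ xs f

  Σ-++ : ∀ {X : Set} (xs ys : List X) f → Σ (xs ++ ys) f ≈ Σ xs f ⊕ Σ ys f
  Σ-++ []       ys f = ≈-sym (+-identityˡ _)
  Σ-++ (x ∷ xs) ys f = ≈-trans (+-congˡ (Σ-++ xs ys f)) (≈-sym (+-assoc _ _ _))

  Σ-map : ∀ {X Y : Set} (g : X → Y) xs f → Σ (map g xs) f ≡ Σ xs (f ∘ g)
  Σ-map g []       f = refl
  Σ-map g (x ∷ xs) f = cong (f (g x) ⊕_) (Σ-map g xs f)

  Σ-cong : ∀ {X : Set} {xs : List X} {f g} → All (λ x → f x ≈ g x) xs → Σ xs f ≈ Σ xs g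
  Σ-cong []           = ≈-refl
  Σ-cong (fx≈gx ∷ es) = +-cong fx≈gx (Σ-cong es)

  Σ-+ : ∀ {X : Set} (xs : List X) f g → Σ xs (λ x → f x ⊕ g x) ≈ Σ xs f ⊕ Σ xs g
  Σ-+ []       f g = ≈-sym (+-identityˡ _)
  Σ-+ (x ∷ xs) f g = ≈-trans (+-congˡ (Σ-+ xs f g)) (interchange _ _ _ _)

  Σ-allPaths-suc : ∀ n f →
    Σ (allPaths (suc n)) f ≈ Σ (allPaths n) (f ∘ (up ∷_)) ⊕ Σ (allPaths n) (f ∘ (down ∷_))
  Σ-allPaths-suc n f = ≈-trans (Σ-++ (map (up ∷_) (allPaths n)) _ f)
    (+-cong (≈-reflexive (Σ-map (up ∷_) (allPaths n) f)) (≈-reflexive (Σ-map (down ∷_) (allPaths n) f)))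

  Σ-allPaths-∷ʳ : ∀ n f → Σ (allPaths (suc n)) f ≈ Σ (allPaths n) (λ γ → f (γ ∷ʳ up) ⊕ f (γ ∷ʳ down))
  Σ-allPaths-∷ʳ zero    f = ≈-trans (+-congˡ (+-identityʳ _)) (≈-sym (+-identityʳ _))
  Σ-allPaths-∷ʳ (suc n) f = begin
    Σ (allPaths (suc (suc n))) f
      ≈⟨ Σ-allPaths-suc (suc n) f ⟩
    Σ (allPaths (suc n)) (f ∘ (up ∷_)) ⊕ Σ (allPaths (suc n)) (f ∘ (down ∷_))
      ≈⟨ +-cong (Σ-allPaths-∷ʳ n _) (Σ-allPaths-∷ʳ n _) ⟩
    Σ (allPaths n) (λ γ → g (up ∷ γ)) ⊕ Σ (allPaths n) (λ γ → g (down ∷ γ))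
      ≈⟨ Σ-allPaths-suc n g ⟨
    Σ (allPaths (suc n)) g ∎
    where g = λ γ → f (γ ∷ʳ up) ⊕ f (γ ∷ʳ down)

  Σ-allPaths-reverse : ∀ n f → Σ (allPaths n) f ≈ Σ (allPaths n) (f ∘ reverse)
  Σ-allPaths-reverse zero    f = ≈-refl
  Σ-allPaths-reverse (suc n) f = begin
    Σ (allPaths (suc n)) f
      ≈⟨ Σ-allPaths-suc n f ⟩
    Σ (allPaths n) (f ∘ (up ∷_)) ⊕ Σ (allPaths n) (f ∘ (down ∷_))
      ≈⟨ +-cong (Σ-allPaths-reverse n _) (Σ-allPaths-reverse n _) ⟩
    Σ (allPaths n) (λ γ → f (up ∷ reverse γ)) ⊕ Σ (allPaths n) (λ γ → f (down ∷ reverse γ))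
      ≈⟨ Σ-+ (allPaths n) _ _ ⟨
    Σ (allPaths n) (λ γ → f (up ∷ reverse γ) ⊕ f (down ∷ reverse γ))
      ≈⟨ Σ-cong (All.universal (λ γ → ≈-reflexive (sym (cong₂ _⊕_ (cong f (LP.reverse-++ γ (up ∷ [])))
                                                                   (cong f (LP.reverse-++ γ (down ∷ [])))))) (allPaths n)) ⟩
    Σ (allPaths n) (λ γ → f (reverse (γ ∷ʳ up)) ⊕ f (reverse (γ ∷ʳ down)))
      ≈⟨ Σ-allPaths-∷ʳ n (f ∘ reverse) ⟨
    Σ (allPaths (suc n)) (f ∘ reverse) ∎

  evalPoly-map-filter : ∀ {X : Set} {P : X → Set} (P? : Decidable P) (w : X → Monomial) a xs →
    evalPoly R a (map w (filter P? xs)) ≈ Σ xs (λ x → if does (P? x) then evalMono R a (w x) else 0#)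
  evalPoly-map-filter P? w a []       = ≈-refl
  evalPoly-map-filter P? w a (x ∷ xs) with does (P? x)
  ... | true  = +-congˡ (evalPoly-map-filter P? w a xs)
  ... | false = ≈-trans (evalPoly-map-filter P? w a xs) (≈-sym (+-identityˡ _))

  evalMono-++ : ∀ a μ ν → evalMono R a (μ ++ ν) ≈ evalMono R a μ ⊗ evalMono R a ν
  evalMono-++ a []      ν = ≈-sym (*-identityˡ _)
  evalMono-++ a (k ∷ μ) ν = ≈-trans (*-congˡ (evalMono-++ a μ ν)) (≈-sym (*-assoc _ _ _))

  evalMono-reverse : ∀ a μ → evalMono R a (reverse μ) ≈ evalMono R a μ
  evalMono-reverse a []      = ≈-refl
  evalMono-reverse a (k ∷ μ) = begin
    evalMono R a (reverse (k ∷ μ))      ≡⟨ cong (evalMono R a) (LP.unfold-reverse k μ) ⟩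
    evalMono R a (reverse μ ∷ʳ k)       ≈⟨ evalMono-++ a (reverse μ) (k ∷ []) ⟩
    evalMono R a (reverse μ) ⊗ (a k ⊗ 1#) ≈⟨ *-cong (evalMono-reverse a μ) (*-identityʳ _) ⟩
    evalMono R a μ ⊗ a k                ≈⟨ *-comm _ _ ⟩
    a k ⊗ evalMono R a μ                ∎

Tpoly≈rename-Spoly : ∀ p n j → Tpoly p n j ≈P rename (mirror p) (Spoly p n j)
Tpoly≈rename-Spoly p n j R a = begin
  evalPoly R a (Tpoly p n j)
    ≈⟨ evalPoly-map-filter (coballot? p j) (weight p (- + j)) a (allPaths n) ⟩
  Σ (allPaths n) termT
    ≈⟨ Σ-allPaths-reverse n termT ⟩
  Σ (allPaths n) (termT ∘ reverse)
    ≈⟨ Σ-cong (All.universal (λ γ → term-reverse γ (ballot? p j γ) (coballot? p j (reverse γ))) (allPaths n)) ⟩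
  Σ (allPaths n) termS
    ≈⟨ evalPoly-map-filter (ballot? p j) (map (mirror p) ∘ weight p (+ 0)) a (allPaths n) ⟨
  evalPoly R a (map (map (mirror p) ∘ weight p (+ 0)) (Slist p n j))
    ≡⟨ cong (evalPoly R a) (LP.map-∘ (Slist p n j)) ⟩
  evalPoly R a (rename (mirror p) (Spoly p n j)) ∎
  where
  open Sums R
  open CommutativeSemiring R using (Carrier; _≈_; 0#; setoid)
    renaming (refl to ≈-refl; trans to ≈-trans; reflexive to ≈-reflexive)
  open import Relation.Binary.Reasoning.Setoid setoid

  term : ∀ {A : Set} → Dec A → Monomial → Carrier
  term A? μ = if does A? then evalMono R a μ else 0#

  termT termS : List Step → Carrier
  termT δ = term (coballot? p j δ) (weight p (- + j) δ)
  termS γ = term (ballot? p j γ) (map (mirror p) (weight p (+ 0) γ))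

  term-reverse : ∀ γ (b : Dec (Ballot p j γ)) (c : Dec (Coballot p j (reverse γ))) →
                 term c (weight p (- + j) (reverse γ)) ≈ term b (map (mirror p) (weight p (+ 0) γ))
  term-reverse γ (yes (end≡j , _)) (yes _) = ≈-trans
    (≈-reflexive (cong (evalMono R a)
      (subst (λ e → weight p (- e) (reverse γ) ≡ reverse (map (mirror p) (weight p (+ 0) γ))) end≡j
             (weight-reverse p (+ 0) γ))))
    (evalMono-reverse a (map (mirror p) (weight p (+ 0) γ)))
  term-reverse γ (yes b) (no ¬c) = ⊥-elim (¬c (Ballot⇒Coballot-reverse p j γ b))
  term-reverse γ (no ¬b) (yes c) =
    ⊥-elim (¬b (subst (Ballot p j) (LP.reverse-involutive γ) (Coballot⇒Ballot-reverse p j (reverse γ) c)))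
  term-reverse γ (no _)  (no _)  = ≈-refl

-- Counting

binom : ℕ → ℕ → ℕ
binom zero    b       = 1
binom (suc a) zero    = 1
binom (suc a) (suc b) = binom a (suc b) + binom (suc a) b

binom≡C : ∀ a b → binom a b ≡ (a + b) C a
binom≡C zero    b       = refl
binom≡C (suc a) zero    = sym (trans (cong (_C suc a) (ℕP.+-identityʳ (suc a))) (nCn≡1 (suc a)))
binom≡C (suc a) (suc b) = begin
  binom a (suc b) + binom (suc a) b          ≡⟨ cong₂ _+_ (binom≡C a (suc b)) (binom≡C (suc a) b) ⟩
  (a + suc b) C a + (suc a + b) C suc a      ≡⟨ cong (λ n → (a + suc b) C a + n C suc a) (ℕP.+-suc a b) ⟨
  (a + suc b) C a + (a + suc b) C suc a      ≡⟨ nCk+nC[k+1]≡[n+1]C[k+1] (a + suc b) a ⟩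
  suc (a + suc b) C suc a                    ∎
  where open ≡-Reasoning

binom-factorials : ∀ a b → binom a b * (a ! * b !) ≡ (a + b) !
binom-factorials zero    b       = trans (ℕP.*-identityˡ _) (ℕP.*-identityˡ _)
binom-factorials (suc a) zero    =
  trans (ℕP.*-identityˡ _) (trans (ℕP.*-identityʳ _) (cong _! (sym (ℕP.+-identityʳ (suc a)))))
binom-factorials (suc a) (suc b) = begin
  (binom a (suc b) + binom (suc a) b) * (suc a ! * suc b !)
    ≡⟨ split (binom a (suc b)) (binom (suc a) b) a b (a !) (b !) ⟩
  suc a * (binom a (suc b) * (a ! * suc b !)) + suc b * (binom (suc a) b * (suc a ! * b !))
    ≡⟨ cong₂ (λ x y → suc a * x + suc b * y) (binom-factorials a (suc b)) (binom-factorials (suc a) b) ⟩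
  suc a * (a + suc b) ! + suc b * (suc a + b) !
    ≡⟨ cong (λ z → suc a * (a + suc b) ! + suc b * z !) (ℕP.+-suc a b) ⟨
  suc a * (a + suc b) ! + suc b * (a + suc b) !
    ≡⟨ ℕP.*-distribʳ-+ ((a + suc b) !) (suc a) (suc b) ⟨
  (suc a + suc b) ! ∎
  where
  open ≡-Reasoning
  split : ∀ x y a b fa fb → (x + y) * ((suc a * fa) * (suc b * fb)) ≡
                            suc a * (x * (fa * (suc b * fb))) + suc b * (y * ((suc a * fa) * fb))
  split = NS.solve-∀

factorials-nonZero : ∀ a b → NonZero (a ! * b !)
factorials-nonZero a b = ℕP.m*n≢0 (a !) (b !) {{a ℕP.!≢0}} {{b ℕP.!≢0}}

binom-absorbˡ : ∀ a b → suc a * binom (suc a) b ≡ suc (a + b) * binom a b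
binom-absorbˡ a b = ℕP.*-cancelʳ-≡ _ _ (a ! * b !) {{factorials-nonZero a b}} (begin
  suc a * binom (suc a) b * (a ! * b !)   ≡⟨ regroup (suc a) (binom (suc a) b) (a !) (b !) ⟩
  binom (suc a) b * (suc a ! * b !)       ≡⟨ binom-factorials (suc a) b ⟩
  suc (a + b) * (a + b) !                 ≡⟨ cong (suc (a + b) *_) (binom-factorials a b) ⟨
  suc (a + b) * (binom a b * (a ! * b !)) ≡⟨ ℕP.*-assoc (suc (a + b)) (binom a b) (a ! * b !) ⟨
  suc (a + b) * binom a b * (a ! * b !)   ∎)
  where
  open ≡-Reasoning
  regroup : ∀ x d fa fb → x * d * (fa * fb) ≡ d * ((x * fa) * fb)
  regroup = NS.solve-∀

binom-absorbʳ : ∀ a b → suc b * binom a (suc b) ≡ suc (a + b) * binom a b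
binom-absorbʳ a b = ℕP.*-cancelʳ-≡ _ _ (a ! * b !) {{factorials-nonZero a b}} (begin
  suc b * binom a (suc b) * (a ! * b !)   ≡⟨ regroup (suc b) (binom a (suc b)) (a !) (b !) ⟩
  binom a (suc b) * (a ! * suc b !)       ≡⟨ binom-factorials a (suc b) ⟩
  (a + suc b) !                           ≡⟨ cong _! (ℕP.+-suc a b) ⟩
  suc (a + b) * (a + b) !                 ≡⟨ cong (suc (a + b) *_) (binom-factorials a b) ⟨
  suc (a + b) * (binom a b * (a ! * b !)) ≡⟨ ℕP.*-assoc (suc (a + b)) (binom a b) (a ! * b !) ⟨
  suc (a + b) * binom a b * (a ! * b !)   ∎)
  where
  open ≡-Reasoning
  regroup : ∀ x d fa fb → x * d * (fa * fb) ≡ d * (fa * (x * fb))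
  regroup = NS.solve-∀

module ℕΣ = Sums ℕP.+-*-commutativeSemiring
open ℕΣ using (Σ)

indicator : ∀ {A : Set} → Dec A → ℕ
indicator A? = if does A? then 1 else 0

indicator-⇔ : ∀ {A B : Set} → A ⇔ B → (A? : Dec A) (B? : Dec B) → indicator A? ≡ indicator B?
indicator-⇔ A⇔B A? B? = cong (if_then 1 else 0) (does-⇔ A⇔B A? B?)

indicator-no : ∀ {A : Set} (A? : Dec A) → ¬ A → indicator A? ≡ 0
indicator-no A? ¬a = cong (if_then 1 else 0) (dec-false A? ¬a)

length-filter : ∀ {X : Set} {P : X → Set} (P? : Decidable P) xs →
                length (filter P? xs) ≡ Σ xs (indicator ∘ P?)
length-filter P? []       = refl
length-filter P? (x ∷ xs) with does (P? x)
... | true  = cong suc (length-filter P? xs)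
... | false = length-filter P? xs

Σ-zero : ∀ {X : Set} (xs : List X) → Σ xs (λ _ → 0) ≡ 0
Σ-zero []       = refl
Σ-zero (x ∷ xs) = Σ-zero xs

count-downs : ∀ n k → Σ (allPaths n) (λ γ → indicator (downs γ ℕ.≟ k)) ≡ n C k
count-downs zero    zero    = refl
count-downs zero    (suc k) = refl
count-downs (suc n) zero    =
  trans (ℕΣ.Σ-allPaths-suc n _) (cong₂ _+_ (count-downs n zero) (Σ-zero (allPaths n)))
count-downs (suc n) (suc k) = trans (ℕΣ.Σ-allPaths-suc n _)
  (trans (cong₂ _+_ (count-downs n (suc k)) (count-downs n k))
         (trans (ℕP.+-comm (n C suc k) (n C k)) (nCk+nC[k+1]≡[n+1]C[k+1] n k)))

ups≡-from-downs : ∀ p m j γ → length γ ≡ m * suc p + j → downs γ ≡ m → ups γ ≡ j + p * m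
ups≡-from-downs p m j γ len downs≡m = ℕP.+-cancelʳ-≡ m _ _ (begin
  ups γ + m        ≡⟨ cong (ups γ ℕ.+_) downs≡m ⟨
  ups γ + downs γ  ≡⟨ ups+downs≡length γ ⟩
  length γ         ≡⟨ len ⟩
  m * suc p + j    ≡⟨ regroup m p j ⟩
  j + p * m + m    ∎)
  where
  open ≡-Reasoning
  regroup : ∀ m p j → m * suc p + j ≡ j + p * m + m
  regroup = NS.solve-∀

endHeight-from-downs : ∀ p m j γ → length γ ≡ m * suc p + j → downs γ ≡ m → endHeight p (+ 0) γ ≡ + j
endHeight-from-downs p m j γ len downs≡m = begin
  endHeight p (+ 0) γ                            ≡⟨ endHeight≡ p (+ 0) γ ⟩
  + 0 ℤ.+ + ups γ ℤ.- + (p * downs γ)            ≡⟨ cong₂ (λ u d → + 0 ℤ.+ + u ℤ.- + (p * d))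
                                                          (ups≡-from-downs p m j γ len downs≡m) downs≡m ⟩
  + 0 ℤ.+ + (j + p * m) ℤ.- + (p * m)            ≡⟨ cong (ℤ._- + (p * m)) (ℤP.+-identityˡ (+ (j + p * m))) ⟩
  + (j + p * m) ℤ.- + (p * m)                    ≡⟨ pos-+-cancel j (p * m) ⟩
  + j                                            ∎
  where open ≡-Reasoning

Rlist-length : ∀ p m j → length (Rlist p (m * suc p + j) j) ≡ (m * suc p + j) C m
Rlist-length p m j = begin
  length (Rlist p n j)                                          ≡⟨ length-filter end? (allPaths n) ⟩
  Σ (allPaths n) (indicator ∘ end?)                             ≡⟨ ℕΣ.Σ-cong (All.map (λ {γ} → same-indicator γ) lengths) ⟩
  Σ (allPaths n) (λ γ → indicator (downs γ ℕ.≟ m))              ≡⟨ count-downs n m ⟩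
  n C m                                                         ∎
  where
  open ≡-Reasoning
  n = m * suc p + j
  lengths = allPaths-length n
  end? = λ γ → endHeight p (+ 0) γ ℤ.≟ + j
  same-indicator : ∀ γ → length γ ≡ n → indicator (end? γ) ≡ indicator (downs γ ℕ.≟ m)
  same-indicator γ len =
    indicator-⇔ (mk⇔ (λ end≡ → downs≡ p m j (+ 0) γ len (trans end≡ (sym (ℤP.+-identityˡ (+ j)))))
                 (endHeight-from-downs p m j γ len))
                (end? γ) (downs γ ℕ.≟ m)

ballotCount : ℕ → ℕ → ℕ → ℕ
ballotCount p n e = Σ (allPaths n) (indicator ∘ ballot? p e)

ballotCount-suc-suc : ∀ p n e → ballotCount p (suc n) (suc e) ≡ ballotCount p n e + ballotCount p n (suc e + p)
ballotCount-suc-suc p n e = trans (ℕΣ.Σ-allPaths-∷ʳ n _)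
  (trans (ℕΣ.Σ-cong (All.universal (λ γ → cong₂ _+_ (via up e γ (cong +_ (ℕP.+-comm e 1)))
                                                     (via down (suc e + p) γ (pos-+-cancel (suc e) p)))
                                   (allPaths n)))
         (ℕΣ.Σ-+ (allPaths n) _ _))
  where
  via : ∀ s e′ γ → stepH p (+ e′) s ≡ + suc e →
        indicator (ballot? p (suc e) (γ ∷ʳ s)) ≡ indicator (ballot? p e′ γ)
  via s e′ γ step≡ = indicator-⇔ (Ballot-∷ʳ p (suc e) e′ γ s step≡) (ballot? p (suc e) (γ ∷ʳ s)) (ballot? p e′ γ)

ballotCount-suc-zero : ∀ p n → ballotCount p (suc n) 0 ≡ ballotCount p n p
ballotCount-suc-zero p n = trans (ℕΣ.Σ-allPaths-∷ʳ n _)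
  (ℕΣ.Σ-cong (All.universal (λ γ → cong₂ _+_
     (indicator-no (ballot? p 0 (γ ∷ʳ up)) (¬Ballot-0-∷ʳ-up p γ))
     (indicator-⇔ (Ballot-∷ʳ p 0 p γ down (ℤP.+-inverseʳ (+ p))) (ballot? p 0 (γ ∷ʳ down)) (ballot? p p γ)))
   (allPaths n)))

ballotCount-short : ∀ p n e → n ℕ.< e → ballotCount p n e ≡ 0
ballotCount-short p n e n<e = trans
  (ℕΣ.Σ-cong (All.map (λ {γ} len → indicator-no (ballot? p e γ) (too-high γ len))
                      (allPaths-length n)))
  (Σ-zero (allPaths n))
  where
  too-high : ∀ γ → length γ ≡ n → ¬ Ballot p e γ
  too-high γ len (end≡e , _) = ℕP.<⇒≱ n<e (begin
    e                  ≤⟨ ℕP.m≤m+n e (p * downs γ) ⟩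
    e + p * downs γ    ≡⟨ ups≡ p e (+ 0) γ (trans end≡e (sym (ℤP.+-identityˡ (+ e)))) ⟨
    ups γ              ≤⟨ ℕP.m≤m+n (ups γ) (downs γ) ⟩
    ups γ + downs γ    ≡⟨ ups+downs≡length γ ⟩
    length γ           ≡⟨ len ⟩
    n                  ∎)
    where open ℕP.≤-Reasoning

ballotCount-diagonal : ∀ p j → ballotCount p j j ≡ 1
ballotCount-diagonal p zero    = refl
ballotCount-diagonal p (suc j) = trans (ballotCount-suc-suc p j j)
  (cong₂ _+_ (ballotCount-diagonal p j) (ballotCount-short p j (suc j + p) (s≤s (ℕP.m≤m+n j p))))

binom-suc-scale : ∀ p a → binom (suc a) (p * suc a) ≡ suc p * binom a (p * suc a)
binom-suc-scale p a = ℕP.*-cancelˡ-≡ _ _ (suc a) (begin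
  suc a * binom (suc a) (p * suc a)          ≡⟨ binom-absorbˡ a (p * suc a) ⟩
  suc (a + p * suc a) * binom a (p * suc a)  ≡⟨ regroup a p (binom a (p * suc a)) ⟩
  suc a * (suc p * binom a (p * suc a))      ∎)
  where
  open ≡-Reasoning
  regroup : ∀ a p x → suc (a + p * suc a) * x ≡ suc a * (suc p * x)
  regroup = NS.solve-∀

ballot-step-arithmetic : ∀ p k j c₁ c₂ A B → let M = suc (p * suc k + j) in
  (p * suc k + j + 1) * c₁ ≡ (j + 1) * B → (M + 1) * c₂ ≡ (suc j + p + 1) * A → suc k * B ≡ M * A →
  (M + 1) * (c₁ + c₂) ≡ (suc j + 1) * (A + B)
ballot-step-arithmetic p k j c₁ c₂ A B IH₁ IH₂ absorb = ℕP.*-cancelˡ-≡ _ _ M (begin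
  M * ((M + 1) * (c₁ + c₂))                           ≡⟨ expand p k j c₁ c₂ ⟩
  (M + 1) * ((p * suc k + j + 1) * c₁) + M * ((M + 1) * c₂) ≡⟨ cong₂ (λ x y → (M + 1) * x + M * y) IH₁ IH₂ ⟩
  (M + 1) * ((j + 1) * B) + M * ((suc j + p + 1) * A) ≡⟨ collect₁ p k j A B ⟩
  Y + p * (M * A)                                     ≡⟨ cong (λ z → Y + p * z) absorb ⟨
  Y + p * (suc k * B)                                 ≡⟨ collect₂ p k j A B ⟨
  M * ((suc j + 1) * (A + B))                         ∎)
  where
  open ≡-Reasoning
  M = suc (p * suc k + j)
  Y = M * suc j * A + M * A + M * suc j * B + suc j * B
  expand : ∀ p k j c₁ c₂ → let M = suc (p * suc k + j) in
    M * ((M + 1) * (c₁ + c₂)) ≡ (M + 1) * ((p * suc k + j + 1) * c₁) + M * ((M + 1) * c₂)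
  expand = NS.solve-∀
  collect₁ : ∀ p k j A B → let M = suc (p * suc k + j) in
    (M + 1) * ((j + 1) * B) + M * ((suc j + p + 1) * A) ≡
    (M * suc j * A + M * A + M * suc j * B + suc j * B) + p * (M * A)
  collect₁ = NS.solve-∀
  collect₂ : ∀ p k j A B → let M = suc (p * suc k + j) in
    M * ((suc j + 1) * (A + B)) ≡ (M * suc j * A + M * A + M * suc j * B + suc j * B) + p * (suc k * B)
  collect₂ = NS.solve-∀

BallotFormula : ℕ → ℕ → ℕ → Set
BallotFormula p k j = (p * k + j + 1) * ballotCount p (k * suc p + j) j ≡ (j + 1) * binom k (p * k + j)

ballotFormula-base : ∀ p j → BallotFormula p 0 j
ballotFormula-base p j rewrite ballotCount-diagonal p j | ℕP.*-zeroʳ p = refl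

ballotFormula-step₀ : ∀ p k → BallotFormula p k p → BallotFormula p (suc k) 0
ballotFormula-step₀ p k IH = begin
  (p * suc k + 0 + 1) * ballotCount p (suc k * suc p + 0) 0
    ≡⟨ cong₂ (λ x n → (x + 1) * ballotCount p n 0) (ℕP.+-identityʳ (p * suc k)) (length≡ p k) ⟩
  (p * suc k + 1) * ballotCount p (suc (k * suc p + p)) 0
    ≡⟨ cong ((p * suc k + 1) *_) (ballotCount-suc-zero p (k * suc p + p)) ⟩
  (p * suc k + 1) * ballotCount p (k * suc p + p) p
    ≡⟨ cong (λ x → (x + 1) * ballotCount p (k * suc p + p) p) (p*suc≡ p k) ⟩
  (p * k + p + 1) * ballotCount p (k * suc p + p) p
    ≡⟨ IH ⟩
  (p + 1) * binom k (p * k + p)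
    ≡⟨ cong (λ b → (p + 1) * binom k b) (p*suc≡ p k) ⟨
  (p + 1) * binom k (p * suc k)
    ≡⟨ cong (_* binom k (p * suc k)) (ℕP.+-comm p 1) ⟩
  suc p * binom k (p * suc k)
    ≡⟨ binom-suc-scale p k ⟨
  binom (suc k) (p * suc k)
    ≡⟨ ℕP.*-identityˡ _ ⟨
  1 * binom (suc k) (p * suc k)
    ≡⟨ cong (λ b → 1 * binom (suc k) b) (ℕP.+-identityʳ (p * suc k)) ⟨
  (0 + 1) * binom (suc k) (p * suc k + 0) ∎
  where
  open ≡-Reasoning
  length≡ : ∀ p k → suc k * suc p + 0 ≡ suc (k * suc p + p)
  length≡ = NS.solve-∀
  p*suc≡ : ∀ p k → p * suc k ≡ p * k + p
  p*suc≡ = NS.solve-∀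
ballotFormula-step : ∀ p k j → BallotFormula p (suc k) j → BallotFormula p k (suc j + p) →
                     BallotFormula p (suc k) (suc j)
ballotFormula-step p k j IH₁ IH₂ = begin
  (p * suc k + suc j + 1) * ballotCount p (suc k * suc p + suc j) (suc j)
    ≡⟨ cong₂ (λ x n → (x + 1) * ballotCount p n (suc j)) (ℕP.+-suc (p * suc k) j) (ℕP.+-suc (suc k * suc p) j) ⟩
  (M + 1) * ballotCount p (suc (suc k * suc p + j)) (suc j)
    ≡⟨ cong ((M + 1) *_) (ballotCount-suc-suc p (suc k * suc p + j) j) ⟩
  (M + 1) * (ballotCount p (suc k * suc p + j) j + ballotCount p (suc k * suc p + j) (suc j + p))
    ≡⟨ cong (λ n → (M + 1) * (ballotCount p (suc k * suc p + j) j + ballotCount p n (suc j + p))) (length≡ p k j) ⟩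
  (M + 1) * (ballotCount p (suc k * suc p + j) j + ballotCount p (k * suc p + (suc j + p)) (suc j + p))
    ≡⟨ ballot-step-arithmetic p k j _ _ _ _
         IH₁
         (subst (λ x → (x + 1) * ballotCount p (k * suc p + (suc j + p)) (suc j + p) ≡ (suc j + p + 1) * binom k x)
                (M≡ p k j) IH₂)
         (trans (binom-absorbˡ k (p * suc k + j)) (sym (binom-absorbʳ k (p * suc k + j)))) ⟩
  (suc j + 1) * (binom k M + binom (suc k) (p * suc k + j))
    ≡⟨ cong (λ b → (suc j + 1) * binom (suc k) b) (ℕP.+-suc (p * suc k) j) ⟨
  (suc j + 1) * binom (suc k) (p * suc k + suc j) ∎
  where
  open ≡-Reasoning
  M = suc (p * suc k + j)
  length≡ : ∀ p k j → suc k * suc p + j ≡ k * suc p + (suc j + p)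
  length≡ = NS.solve-∀
  M≡ : ∀ p k j → p * k + (suc j + p) ≡ suc (p * suc k + j)
  M≡ = NS.solve-∀

ballotCount-formula : ∀ p k j → BallotFormula p k j
ballotCount-formula p zero    j       = ballotFormula-base p j
ballotCount-formula p (suc k) zero    = ballotFormula-step₀ p k (ballotCount-formula p k p)
ballotCount-formula p (suc k) (suc j) =
  ballotFormula-step p k j (ballotCount-formula p (suc k) j) (ballotCount-formula p k (suc j + p))

Slist-length : ∀ p m j → (p * m + j + 1) * length (Slist p (m * suc p + j) j) ≡ (j + 1) * ((m * suc p + j) C m)
Slist-length p m j = begin
  (p * m + j + 1) * length (Slist p n j)      ≡⟨ cong ((p * m + j + 1) *_) (length-filter (ballot? p j) (allPaths n)) ⟩
  (p * m + j + 1) * ballotCount p n j         ≡⟨ ballotCount-formula p m j ⟩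
  (j + 1) * binom m (p * m + j)               ≡⟨ cong ((j + 1) *_) (binom≡C m (p * m + j)) ⟩
  (j + 1) * ((m + (p * m + j)) C m)           ≡⟨ cong (λ x → (j + 1) * (x C m)) (regroup m p j) ⟩
  (j + 1) * (n C m)                           ∎
  where
  open ≡-Reasoning
  n = m * suc p + j
  regroup : ∀ m p j → m + (p * m + j) ≡ m * suc p + j
  regroup = NS.solve-∀

proposition3p1 : (p m j : ℕ) → 1 ≤ p → 1 ≤ m → j ≤ p →
    let n = m * suc p + j in
    -- (i)
    ((γ : List Step) → IsS p n j γ → take p γ ≡ replicate p up)
    -- (ii)
    × (j ≡ 0 → (γ : List Step) → IsS p n 0 γ →
         ∃[ δ ] (γ ≡ δ ++ (down ∷ []) × endHeight p (+ 0) δ ≡ + p))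
    -- (iii)
    × (IsHomogeneous m (Between (- (+ (m * p))) (+ ((m ∸ 1) * p + j))) (Rpoly p n j)
       × IsHomogeneous m (Between (+ 0) (+ ((m ∸ 1) * p + j))) (Spoly p n j)
       × IsHomogeneous m (Between (- (+ (j + m * p))) (- (+ p))) (Tpoly p n j))
    -- (iv)
    × (((γ : List Step) → IsS p n j γ →
          vertices p 0 (- (+ j)) (hat p n γ) ≡ reverse (map (reflect n) (vertices p 0 (+ 0) γ))
          × IsŜ p n j (hat p n γ))
       × ((γ δ : List Step) → IsS p n j γ → IsS p n j δ → hat p n γ ≡ hat p n δ → γ ≡ δ)
       × ((δ : List Step) → IsŜ p n j δ → ∃[ γ ] (IsS p n j γ × hat p n γ ≡ δ))
       × (Tpoly p n j ≈P rename (λ k → (- (+ p)) ℤ.- k) (Spoly p n j)))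
    -- (v)
    × (length (Rlist p n j) ≡ (m * suc p + j) C m
       × (p * m + j + 1) * length (Slist p n j) ≡ (j + 1) * ((m * suc p + j) C m))
proposition3p1 p m j 1≤p 1≤m _ =
  (λ γ ((len , _) , min≡0) →
     nonnegative⇒take-up p p 0 γ ℕP.≤-refl (subst (p ≤_) (sym len) p≤n) (minH≡0⇒nonnegative p γ min≡0))
  , (λ _ γ → S-last-step p n γ (ℕP.≤-trans 1≤p p≤n))
  , (Rpoly-homogeneous p m j 1≤m , Spoly-homogeneous p m j 1≤m , Tpoly-homogeneous p m j)
  , (hat-IsS p n j , hat-injective p n j , hat-surjective p n j , Tpoly≈rename-Spoly p n j)
  , (Rlist-length p m j , Slist-length p m j)
  where
  n = m * suc p + j
  p≤n : p ≤ n
  p≤n = ℕP.≤-trans (ℕP.n≤1+n p) (ℕP.≤-trans (ℕP.m≤n*m (suc p) m {{ℕ.>-nonZero 1≤m}}) (ℕP.m≤m+n _ j))
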